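{- For all integers $n\ge m\ge 6$, $\mathrm{opt}^{P}_{B}(T_{n,m}) = \lceil (m-1)/2\rceil$.
   Context: $T_{n,m}$ is the $n\times m$ torus grid: squares $(i,j)$ with row indices modulo $n$, column indices modulo $m$. Blocks occupy some squares; a single robot starts on the free square $(1,1)$. A move: choose one of the four directions; the robot slides (wrapping around) and stops on the last free square before a block; if the line contains no block, the robot passes over every square of that line and ends where it started. The robot passes over every square it occupies during a move. A set of blocks is a solution if every free square is passed over during some sequence of moves from the start; $\mathrm{opt}^{P}_{B}(T_{n,m})$ is the minimum number of blocks in a solution. -}

module Defs where

open import Data.Nat using (ℕ; zero; suc; _≤_; _<_; _<?_; s≤s)
open import Data.Fin using (Fin; zero; suc; toℕ; fromℕ; fromℕ<; inject₁)
open import Data.Bool using (Bool; true; false; if_then_else_)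
open import Data.Product using (_×_; _,_; Σ; ∃; ∃-syntax)
open import Data.Sum using (_⊎_)
open import Data.Empty using (⊥)
open import Data.Vec using (tabulate)
open import Data.Vec using () renaming (sum to vsum)
open import Relation.Nullary using (¬_; yes; no)
open import Relation.Binary.PropositionalEquality using (_≡_)

next : ∀ {n} → Fin n → Fin n
next {suc k} i with toℕ i <? k
... | yes p = fromℕ< (s≤s p)
... | no _  = zero

prev : ∀ {n} → Fin n → Fin n
prev {suc k} zero    = fromℕ k
prev {suc k} (suc i) = inject₁ i

-- Squares of the torus T_{n,m}: (row mod n, column mod m).  0-indexed,
-- so the paper's square (1,1) is (zero , zero).
Pos : ℕ → ℕ → Set
Pos n m = Fin n × Fin m

start : ∀ {n m} → Pos (suc n) (suc m)
start = zero , zero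

data Dir : Set where
  up down left right : Dir

step : ∀ {n m} → Dir → Pos n m → Pos n m
step up    (i , j) = prev i , j
step down  (i , j) = next i , j
step left  (i , j) = i , prev j
step right (i , j) = i , next j

stepN : ∀ {n m} → ℕ → Dir → Pos n m → Pos n m
stepN zero    d p = p
stepN (suc k) d p = step d (stepN k d p)

lineLen : ℕ → ℕ → Dir → ℕ
lineLen n m up    = n
lineLen n m down  = n
lineLen n m left  = m
lineLen n m right = m

Blocks : ℕ → ℕ → Set
Blocks n m = Fin n → Fin m → Bool

Blocked : ∀ {n m} → Blocks n m → Pos n m → Set
Blocked B (i , j) = B i j ≡ true

numBlocks : ∀ {n m} → Blocks n m → ℕ
numBlocks B = vsum (tabulate (λ i → vsum (tabulate (λ j → if B i j then 1 else 0))))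

-- Move from p in direction d, ending at q, passing over square x.
-- Either the robot is stopped: the squares p, p+d, ..., p+kd are free and
-- p+(k+1)d is a block; it ends at p+kd and passes over p, ..., p+kd.
-- Or the whole line is free: it passes over every square of the line and
-- ends where it started.
data Move {n m} (B : Blocks n m) (p : Pos n m) (d : Dir) : Pos n m → Pos n m → Set where
  stopped : ∀ k j →
            (∀ i → i ≤ k → ¬ Blocked B (stepN i d p)) →
            Blocked B (stepN (suc k) d p) →
            j ≤ k →
            Move B p d (stepN k d p) (stepN j d p)
  noBlock : ∀ j →
            (∀ i → i < lineLen n m d → ¬ Blocked B (stepN i d p)) →
            j < lineLen n m d →
            Move B p d p (stepN j d p)

data Reach {n m} (B : Blocks (suc n) (suc m)) : Pos (suc n) (suc m) → Set where
  here : Reach B start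
  move : ∀ {p q x} d → Reach B p → Move B p d q x → Reach B q

Covered : ∀ {n m} → Blocks (suc n) (suc m) → Pos (suc n) (suc m) → Set
Covered B x = ∃[ p ] ∃[ d ] ∃[ q ] (Reach B p × Move B p d q x)

IsSolution : ∀ {n m} → Blocks (suc n) (suc m) → Set
IsSolution B = ¬ Blocked B start × (∀ x → ¬ Blocked B x → Covered B x)

-- OptIs n m k : opt^P_B(T_{n,m}) = k, i.e. k is the minimum number of blocks
-- of a solution on the n×m torus.  (For n = 0 or m = 0 there is no start
-- square; that degenerate case is set to ⊥ and never used.)
OptIs : ℕ → ℕ → ℕ → Set
OptIs (suc n) (suc m) k =
  (Σ (Blocks (suc n) (suc m)) λ B → IsSolution B × numBlocks B ≡ k) ×
  (∀ (B : Blocks (suc n) (suc m)) → IsSolution B → k ≤ numBlocks B)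
OptIs _ _ _ = ⊥

module Submission where

-- opt^P_B(T_{n,m}) = ⌈(m-1)/2⌉ for n ≥ m ≥ 6.  We work on the torus with
-- n + 1 rows and m + 1 columns (0-indexed, start square (0,0)), where the
-- claim reads: the least number of blocks of a solution is k = ⌈m/2⌉.
--
-- Lower bound.  Call a row active if it is row 0 or adjacent to a row holding
-- a block, and a column active if it is column 0 or adjacent to a column
-- holding a block of an active row.  A move stops next to a block, so every
-- reachable square lies in an active row and an active column, and every
-- covered square in an active row or an active column.  A block activates at
-- most two rows (resp. columns), so either all n + 1 rows are active and
-- n ≤ 2·#blocks, or some row is inactive; then each of its m + 1 squares is
-- a block or lies in an active column, and again m ≤ 2·#blocks.
--
-- Upper bound.  Put one block in each row t < k, in pairwise distinct columns
-- col t (a staircase placement).  A robot in row t reaches the columns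
-- col t ± 1, one in column col t reaches the rows t ± 1, and once every column
-- has been entered all free squares are covered.  The columns follow a strip
-- pattern of period 4 rows × 8 columns whose rows enter all eight columns of
-- the strip and the first row of the next strip; depending on (m + 1) mod 8
-- the strips are completed by no, one or three tail rows, or preceded by two
-- head rows.

open import Defs
open import Data.Nat using (ℕ; zero; suc; z<s; _+_; _*_; _∸_; _⊓_; _≤_; _<_; _<ᵇ_; _≡ᵇ_; z≤n; s≤s; ⌈_/2⌉; NonZero)
open import Data.Nat.Properties
open import Data.Nat.DivMod using (_%_; _/_; m<n⇒m%n≡m; n%n≡0; %-distribˡ-+; m%n%n≡m%n; [m+n]%n≡m%n; m%n<n; m≡m%n+[m/n]*n)
open import Data.Nat.Tactic.RingSolver using (solve-∀)
open import Data.Nat.GeneralisedArithmetic using (fold; fold-+)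
open import Data.Fin using (Fin; zero; suc; toℕ; fromℕ; fromℕ<; inject₁)
open import Data.Fin.Properties using (toℕ-injective; toℕ<n; toℕ-fromℕ; toℕ-fromℕ<; toℕ-inject₁; any?)
open import Data.Product using (Σ; _×_; _,_; proj₁; proj₂)
open import Data.Sum using (_⊎_; inj₁; inj₂)
open import Data.Empty using (⊥-elim)
open import Data.Bool using (Bool; true; false; _∧_; if_then_else_) renaming (_≟_ to _≟-Bool_)
open import Data.Bool.Properties using (T-≡; T-∧; not-¬)
open import Data.Vec using (tabulate) renaming (sum to vsum)
open import Function.Bundles using (Equivalence)
open import Relation.Nullary using (¬_; yes; no)
open import Relation.Binary.PropositionalEquality
open import Algebra.Properties.Semiring.Sum +-*-semiring
  using (sum; ∑-comm; ∑-distrib-+; sum-cong-≗; sum-replicate-zero; sum-init-last; *-distribˡ-sum)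

fold-comm : ∀ {A : Set} (f : A → A) i x → fold (f x) f i ≡ f (fold x f i)
fold-comm f i x = trans (sym (fold-+ x f i {1})) (cong (fold x f) (+-comm i 1))

fold-inverse : ∀ {A : Set} (f g : A → A) → (∀ x → g (f x) ≡ x) → ∀ i x → fold (fold x f i) g i ≡ x
fold-inverse f g gf zero    x = refl
fold-inverse f g gf (suc i) x = begin
  g (fold (f (fold x f i)) g i) ≡⟨ cong (λ y → g (fold y g i)) (sym (fold-comm f i x)) ⟩
  g (fold (fold (f x) f i) g i) ≡⟨ cong g (fold-inverse f g gf i (f x)) ⟩
  g (f x)                       ≡⟨ gf x ⟩
  x                             ∎
  where open ≡-Reasoning

record Cycle (N : ℕ) : Set where
  field
    succ pred  : Fin N → Fin N
    pred-succ  : ∀ x → pred (succ x) ≡ x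
    dist       : Fin N → Fin N → ℕ
    dist<N     : ∀ x y → dist x y < N
    fold-dist  : ∀ x y → fold x succ (dist x y) ≡ y
    dist-fold  : ∀ x i → i < N → dist x (fold x succ i) ≡ i
    period     : ∀ x → fold x succ N ≡ x

+-%-absorb : ∀ N .{{_ : NonZero N}} a b → (a + b % N) % N ≡ (a + b) % N
+-%-absorb N a b = begin
  (a + b % N) % N          ≡⟨ %-distribˡ-+ a (b % N) N ⟩
  (a % N + b % N % N) % N  ≡⟨ cong (λ z → (a % N + z) % N) (m%n%n≡m%n b N) ⟩
  (a % N + b % N) % N      ≡⟨ sym (%-distribˡ-+ a b N) ⟩
  (a + b) % N              ∎
  where open ≡-Reasoning

%-+-absorb : ∀ N .{{_ : NonZero N}} a b → (a % N + b) % N ≡ (a + b) % N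
%-+-absorb N a b = begin
  (a % N + b) % N  ≡⟨ cong (_% N) (+-comm (a % N) b) ⟩
  (b + a % N) % N  ≡⟨ +-%-absorb N b a ⟩
  (b + a) % N      ≡⟨ cong (_% N) (+-comm b a) ⟩
  (a + b) % N      ∎
  where open ≡-Reasoning

+N-% : ∀ N .{{_ : NonZero N}} a → a < N → (a + N) % N ≡ a
+N-% N a a<N = trans ([m+n]%n≡m%n a N) (m<n⇒m%n≡m a<N)

%-injective : ∀ M .{{_ : NonZero M}} {u v} → 0 < u → u ≤ M → 0 < v → v ≤ M → u % M ≡ v % M → u ≡ v
%-injective M {u} {v} 0<u u≤M 0<v v≤M eq with m≤n⇒m<n∨m≡n u≤M | m≤n⇒m<n∨m≡n v≤M
... | inj₁ u<M | inj₁ v<M = trans (sym (m<n⇒m%n≡m u<M)) (trans eq (m<n⇒m%n≡m v<M))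
... | inj₂ u≡M | inj₂ v≡M = trans u≡M (sym v≡M)
... | inj₂ u≡M | inj₁ v<M = ⊥-elim (<⇒≢ 0<v (trans (sym (trans (cong (_% M) u≡M) (n%n≡0 M))) (trans eq (m<n⇒m%n≡m v<M))))
... | inj₁ u<M | inj₂ v≡M = ⊥-elim (<⇒≢ 0<u (trans (sym (trans (cong (_% M) v≡M) (n%n≡0 M))) (trans (sym eq) (m<n⇒m%n≡m u<M))))

module _ {L : ℕ} where

  private
    N : ℕ
    N = suc L

  toℕ-next : (x : Fin N) → toℕ (next x) ≡ suc (toℕ x) % N
  toℕ-next x with toℕ x <? L
  ... | yes x<L = trans (toℕ-fromℕ< (s≤s x<L)) (sym (m<n⇒m%n≡m (s≤s x<L)))
  ... | no  x≮L = sym (trans (cong (λ z → suc z % N) x≡L) (n%n≡0 N))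
    where x≡L : toℕ x ≡ L
          x≡L = ≤-antisym (≤-pred (toℕ<n x)) (≮⇒≥ x≮L)

  toℕ-fold-next : ∀ i (x : Fin N) → toℕ (fold x next i) ≡ (toℕ x + i) % N
  toℕ-fold-next zero    x = sym (trans (cong (_% N) (+-identityʳ (toℕ x))) (m<n⇒m%n≡m (toℕ<n x)))
  toℕ-fold-next (suc i) x = begin
    toℕ (next (fold x next i))  ≡⟨ toℕ-next (fold x next i) ⟩
    suc (toℕ (fold x next i)) % N ≡⟨ cong (λ z → suc z % N) (toℕ-fold-next i x) ⟩
    (1 + (toℕ x + i) % N) % N   ≡⟨ +-%-absorb N 1 (toℕ x + i) ⟩
    suc (toℕ x + i) % N         ≡⟨ cong (_% N) (sym (+-suc (toℕ x) i)) ⟩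
    (toℕ x + suc i) % N         ∎
    where open ≡-Reasoning

  toℕ-prev : (x : Fin N) → toℕ (prev x) ≡ (toℕ x + L) % N
  toℕ-prev zero = trans (toℕ-fromℕ L) (sym (m<n⇒m%n≡m (s≤s ≤-refl)))
  toℕ-prev (suc i) = begin
    toℕ (inject₁ i)         ≡⟨ toℕ-inject₁ i ⟩
    toℕ i                   ≡⟨ sym (+N-% N (toℕ i) (<-trans (toℕ<n i) (s≤s ≤-refl))) ⟩
    (toℕ i + N) % N         ≡⟨ cong (_% N) (+-suc (toℕ i) L) ⟩
    (suc (toℕ i) + L) % N   ∎
    where open ≡-Reasoning

  prev-next : (x : Fin N) → prev (next x) ≡ x
  prev-next x = toℕ-injective (begin
    toℕ (prev (next x))         ≡⟨ toℕ-prev (next x) ⟩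
    (toℕ (next x) + L) % N      ≡⟨ cong (λ z → (z + L) % N) (toℕ-next x) ⟩
    (suc (toℕ x) % N + L) % N   ≡⟨ %-+-absorb N (suc (toℕ x)) L ⟩
    (suc (toℕ x) + L) % N       ≡⟨ cong (_% N) (sym (+-suc (toℕ x) L)) ⟩
    (toℕ x + N) % N             ≡⟨ +N-% N (toℕ x) (toℕ<n x) ⟩
    toℕ x                       ∎)
    where open ≡-Reasoning

  next-prev : (x : Fin N) → next (prev x) ≡ x
  next-prev x = toℕ-injective (begin
    toℕ (next (prev x))         ≡⟨ toℕ-next (prev x) ⟩
    (1 + toℕ (prev x)) % N      ≡⟨ cong (λ z → (1 + z) % N) (toℕ-prev x) ⟩
    (1 + (toℕ x + L) % N) % N   ≡⟨ +-%-absorb N 1 (toℕ x + L) ⟩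
    (1 + (toℕ x + L)) % N       ≡⟨ cong (_% N) (trans (+-comm 1 (toℕ x + L)) (trans (+-assoc (toℕ x) L 1) (cong (toℕ x +_) (+-comm L 1)))) ⟩
    (toℕ x + N) % N             ≡⟨ +N-% N (toℕ x) (toℕ<n x) ⟩
    toℕ x                       ∎)
    where open ≡-Reasoning

  private
    swap-+ : ∀ a b c → a + (b + c) ≡ b + (a + c)
    swap-+ a b c = trans (sym (+-assoc a b c)) (trans (cong (_+ c) (+-comm a b)) (+-assoc b a c))

  forward : Cycle N
  forward = record
    { succ = next ; pred = prev ; pred-succ = prev-next
    ; dist = dist ; dist<N = λ x y → m%n<n (toℕ y + (N ∸ toℕ x)) N
    ; fold-dist = fold-dist ; dist-fold = dist-fold ; period = period }
    where
      dist : Fin N → Fin N → ℕ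
      dist x y = (toℕ y + (N ∸ toℕ x)) % N

      a+[N∸a] : ∀ (x : Fin N) → toℕ x + (N ∸ toℕ x) ≡ N
      a+[N∸a] x = m+[n∸m]≡n (<⇒≤ (toℕ<n x))

      fold-dist : ∀ x y → fold x next (dist x y) ≡ y
      fold-dist x y = toℕ-injective (begin
        toℕ (fold x next (dist x y))          ≡⟨ toℕ-fold-next (dist x y) x ⟩
        (toℕ x + dist x y) % N                ≡⟨ +-%-absorb N (toℕ x) _ ⟩
        (toℕ x + (toℕ y + (N ∸ toℕ x))) % N   ≡⟨ cong (_% N) (trans (swap-+ (toℕ x) (toℕ y) _) (cong (toℕ y +_) (a+[N∸a] x))) ⟩
        (toℕ y + N) % N                       ≡⟨ +N-% N (toℕ y) (toℕ<n y) ⟩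
        toℕ y                                 ∎)
        where open ≡-Reasoning

      dist-fold : ∀ x i → i < N → dist x (fold x next i) ≡ i
      dist-fold x i i<N = begin
        (toℕ (fold x next i) + (N ∸ toℕ x)) % N  ≡⟨ cong (λ z → (z + (N ∸ toℕ x)) % N) (toℕ-fold-next i x) ⟩
        ((toℕ x + i) % N + (N ∸ toℕ x)) % N      ≡⟨ %-+-absorb N (toℕ x + i) _ ⟩
        (toℕ x + i + (N ∸ toℕ x)) % N            ≡⟨ cong (_% N) (trans (+-assoc (toℕ x) i _) (trans (swap-+ (toℕ x) i _) (cong (i +_) (a+[N∸a] x)))) ⟩
        (i + N) % N                              ≡⟨ +N-% N i i<N ⟩
        i                                        ∎
        where open ≡-Reasoning

      period : ∀ x → fold x next N ≡ x
      period x = toℕ-injective (trans (toℕ-fold-next N x) (+N-% N (toℕ x) (toℕ<n x)))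

  backward : Cycle N
  backward = record
    { succ = prev ; pred = next ; pred-succ = next-prev
    ; dist = λ x y → dist y x ; dist<N = λ x y → dist<N y x
    ; fold-dist = fold-dist′ ; dist-fold = dist-fold′ ; period = period′ }
    where
      open Cycle forward

      undo : ∀ i x → fold (fold x next i) prev i ≡ x
      undo = fold-inverse next prev prev-next

      redo : ∀ i x → fold (fold x prev i) next i ≡ x
      redo = fold-inverse prev next next-prev

      fold-dist′ : ∀ x y → fold x prev (dist y x) ≡ y
      fold-dist′ x y = trans (cong (λ z → fold z prev (dist y x)) (sym (fold-dist y x))) (undo (dist y x) y)

      dist-fold′ : ∀ x i → i < N → dist (fold x prev i) x ≡ i
      dist-fold′ x i i<N = trans (cong (dist (fold x prev i)) (sym (redo i x))) (dist-fold (fold x prev i) i i<N)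

      period′ : ∀ x → fold x prev N ≡ x
      period′ x = trans (cong (λ z → fold z prev N) (sym (period x))) (undo N x)

move-end-free : ∀ {n m} {B : Blocks (suc n) (suc m)} {p d q x} → Move B p d q x → ¬ Blocked B q
move-end-free (stopped k j free _ _) = free k ≤-refl
move-end-free {d = up}    (noBlock j free _) = free 0 z<s
move-end-free {d = down}  (noBlock j free _) = free 0 z<s
move-end-free {d = left}  (noBlock j free _) = free 0 z<s
move-end-free {d = right} (noBlock j free _) = free 0 z<s

reach-free : ∀ {n m} {B : Blocks (suc n) (suc m)} → ¬ Blocked B start → ∀ {p} → Reach B p → ¬ Blocked B p
reach-free start-free here           = start-free
reach-free start-free (move d _ mv) = move-end-free mv

-- Motion along one line of the torus (traversed in direction d), with the
-- squares of the line numbered by a cyclic order C compatible with d.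
module Line {n m} (B : Blocks (suc n) (suc m)) (start-free : ¬ Blocked B start) (d : Dir)
  {L} (C : Cycle (suc L)) (pos : Fin (suc L) → Pos (suc n) (suc m))
  (stepN-pos : ∀ i x → stepN i d (pos x) ≡ pos (fold x (Cycle.succ C) i))
  (length : lineLen (suc n) (suc m) d ≡ suc L) where

  open Cycle C

  OnlyBlock : Fin (suc L) → Set
  OnlyBlock c = Blocked B (pos c) × (∀ y → Blocked B (pos y) → y ≡ c)

  private
    split : ∀ {i l} → i < l → Σ ℕ λ l-1 → l ≡ suc l-1 × i ≤ l-1
    split (s≤s i≤) = _ , refl , i≤

    hits : ∀ {x c i} → dist x c ≡ i → fold x succ i ≡ c
    hits {x} {c} dist≡ = subst (λ j → fold x succ j ≡ c) dist≡ (fold-dist x c)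

    blocked-at : ∀ {y z} → y ≡ z → Blocked B (pos z) → Blocked B (pos y)
    blocked-at y≡z = subst (λ w → Blocked B (pos w)) (sym y≡z)

    no-early-return : ∀ c i → suc i < suc L → fold c succ (suc i) ≢ c
    no-early-return c i si<N ret = 1+n≢0 (trans (sym (dist-fold c (suc i) si<N))
                                        (trans (cong (dist c) ret) (dist-fold c 0 z<s)))

  stop-before : ∀ {x c} → Reach B (pos x) → OnlyBlock c → Reach B (pos (pred c))
  stop-before {x} {c} r (blocked-c , only) with dist x c in dist≡
  ... | zero  = ⊥-elim (reach-free start-free r (blocked-at (hits dist≡) blocked-c))
  ... | suc k = subst (Reach B) ends (move d r (stopped k 0 free blocked z≤n))
    where
      hit : fold x succ (suc k) ≡ c
      hit = hits dist≡
      k<N : suc k < suc L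
      k<N = subst (_< suc L) dist≡ (dist<N x c)
      free : ∀ i → i ≤ k → ¬ Blocked B (stepN i d (pos x))
      free i i≤k b = <⇒≢ (s≤s i≤k) (trans (sym (dist-fold x i (≤-<-trans (n≤1+n i) (≤-<-trans (s≤s i≤k) k<N))))
                        (trans (cong (dist x) (only _ (subst (Blocked B) (stepN-pos i x) b))) dist≡))
      blocked : Blocked B (stepN (suc k) d (pos x))
      blocked = subst (Blocked B) (sym (trans (stepN-pos (suc k) x) (cong pos hit))) blocked-c
      ends : stepN k d (pos x) ≡ pos (pred c)
      ends = trans (stepN-pos k x) (cong pos (trans (sym (pred-succ _)) (cong pred hit)))

  cover-after-block : ∀ {c} → Reach B (pos (succ c)) → OnlyBlock c →
                      ∀ y → ¬ Blocked B (pos y) → Covered B (pos y)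
  cover-after-block {c} r (blocked-c , only) y free-y with m≤n⇒m<n∨m≡n (≤-pred (dist<N (succ c) y))
  ... | inj₂ j≡L = ⊥-elim (free-y (blocked-at y≡c blocked-c))
    where y≡c : y ≡ c
          y≡c = begin
            y                                   ≡⟨ sym (fold-dist (succ c) y) ⟩
            fold (succ c) succ (dist (succ c) y) ≡⟨ cong (λ j → fold (succ c) succ j) j≡L ⟩
            fold (succ c) succ L                ≡⟨ fold-comm succ L c ⟩
            fold c succ (suc L)                 ≡⟨ period c ⟩
            c                                   ∎
            where open ≡-Reasoning
  ... | inj₁ j<L with L-1 , L≡ , j≤ ← split j<L =
    pos (succ c) , d , _ , r , subst (Move B (pos (succ c)) d _) (trans (stepN-pos j (succ c)) (cong pos (fold-dist (succ c) y))) mv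
    where
      j = dist (succ c) y
      around : ∀ i → fold (succ c) succ i ≡ fold c succ (suc i)
      around i = fold-comm succ i c
      free : ∀ i → i ≤ L-1 → ¬ Blocked B (stepN i d (pos (succ c)))
      free i i≤ b = no-early-return c i (s≤s (subst (suc i ≤_) (sym L≡) (s≤s i≤)))
                      (only _ (subst (Blocked B) (trans (stepN-pos i (succ c)) (cong pos (around i))) b))
      returns : fold (succ c) succ (suc L-1) ≡ c
      returns = trans (around (suc L-1)) (trans (cong (λ l → fold c succ (suc l)) (sym L≡)) (period c))
      blocked : Blocked B (stepN (suc L-1) d (pos (succ c)))
      blocked = subst (Blocked B) (sym (trans (stepN-pos (suc L-1) (succ c)) (cong pos returns))) blocked-c
      mv : Move B (pos (succ c)) d (stepN L-1 d (pos (succ c))) (stepN j d (pos (succ c)))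
      mv = stopped L-1 j free blocked j≤

  cover-blockless : ∀ {x} → Reach B (pos x) → (∀ y → ¬ Blocked B (pos y)) → ∀ y → Covered B (pos y)
  cover-blockless {x} r no-block y =
    pos x , d , pos x , r , subst (Move B (pos x) d (pos x)) (trans (stepN-pos j x) (cong pos (fold-dist x y))) mv
    where
      j = dist x y
      mv : Move B (pos x) d (pos x) (stepN j d (pos x))
      mv = noBlock j (λ i _ b → no-block _ (subst (Blocked B) (stepN-pos i x) b)) (subst (j <_) (sym length) (dist<N x y))

stepN-right : ∀ {n m} (r : Fin n) i (x : Fin (suc m)) → stepN i right (r , x) ≡ (r , fold x next i)
stepN-right r zero    x = refl
stepN-right r (suc i) x = cong (step right) (stepN-right r i x)

stepN-left : ∀ {n m} (r : Fin n) i (x : Fin (suc m)) → stepN i left (r , x) ≡ (r , fold x prev i)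
stepN-left r zero    x = refl
stepN-left r (suc i) x = cong (step left) (stepN-left r i x)

stepN-down : ∀ {n m} (c : Fin m) i (x : Fin (suc n)) → stepN i down (x , c) ≡ (fold x next i , c)
stepN-down c zero    x = refl
stepN-down c (suc i) x = cong (step down) (stepN-down c i x)

stepN-up : ∀ {n m} (c : Fin m) i (x : Fin (suc n)) → stepN i up (x , c) ≡ (fold x prev i , c)
stepN-up c zero    x = refl
stepN-up c (suc i) x = cong (step up) (stepN-up c i x)

module TorusLines {n m} (B : Blocks (suc n) (suc m)) (start-free : ¬ Blocked B start) where

  private
    module Right (r : Fin (suc n)) = Line B start-free right forward (r ,_) (stepN-right r) refl
    module Left  (r : Fin (suc n)) = Line B start-free left backward (r ,_) (stepN-left r) refl
    module Down  (c : Fin (suc m)) = Line B start-free down forward (_, c) (stepN-down c) refl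
    module Up    (c : Fin (suc m)) = Line B start-free up backward (_, c) (stepN-up c) refl

  RowOnlyBlock : Fin (suc n) → Fin (suc m) → Set
  RowOnlyBlock r c = B r c ≡ true × (∀ j → B r j ≡ true → j ≡ c)

  ColOnlyBlock : Fin (suc m) → Fin (suc n) → Set
  ColOnlyBlock c s = B s c ≡ true × (∀ i → B i c ≡ true → i ≡ s)

  reach-left-of : ∀ {r x c} → Reach B (r , x) → RowOnlyBlock r c → Reach B (r , prev c)
  reach-left-of {r} = Right.stop-before r

  reach-right-of : ∀ {r x c} → Reach B (r , x) → RowOnlyBlock r c → Reach B (r , next c)
  reach-right-of {r} = Left.stop-before r

  reach-above : ∀ {c x s} → Reach B (x , c) → ColOnlyBlock c s → Reach B (prev s , c)
  reach-above {c} = Down.stop-before c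

  reach-below : ∀ {c x s} → Reach B (x , c) → ColOnlyBlock c s → Reach B (next s , c)
  reach-below {c} = Up.stop-before c

  cover-column-one : ∀ {c x s} → Reach B (x , c) → ColOnlyBlock c s → ∀ y → ¬ Blocked B (y , c) → Covered B (y , c)
  cover-column-one {c} r only = Down.cover-after-block c (reach-below r only) only

  cover-column-none : ∀ {c x} → Reach B (x , c) → (∀ i → ¬ Blocked B (i , c)) → ∀ y → Covered B (y , c)
  cover-column-none {c} = Down.cover-blockless c

vsum-tabulate : ∀ {k} (f : Fin k → ℕ) → vsum (tabulate f) ≡ sum f
vsum-tabulate {zero}  f = refl
vsum-tabulate {suc k} f = cong (f zero +_) (vsum-tabulate (λ i → f (suc i)))

ind : Bool → ℕ
ind b = if b then 1 else 0

numBlocks-sum : ∀ {n m} (B : Blocks n m) → numBlocks B ≡ sum (λ i → sum (λ j → ind (B i j)))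
numBlocks-sum B = trans (vsum-tabulate (λ i → vsum (tabulate (λ j → ind (B i j)))))
                        (sum-cong-≗ (λ i → vsum-tabulate (λ j → ind (B i j))))

sum-mono : ∀ {k} {f g : Fin k → ℕ} → (∀ i → f i ≤ g i) → sum f ≤ sum g
sum-mono {zero}  f≤g = z≤n
sum-mono {suc k} f≤g = +-mono-≤ (f≤g zero) (sum-mono (λ i → f≤g (suc i)))

sum-point : ∀ {k} (f : Fin k → ℕ) i → f i ≤ sum f
sum-point f zero    = m≤m+n _ _
sum-point f (suc i) = ≤-trans (sum-point (λ j → f (suc j)) i) (m≤n+m _ (f zero))

sum-≥-length : ∀ {k} (f : Fin k → ℕ) → (∀ i → 1 ≤ f i) → k ≤ sum f
sum-≥-length {zero}  f pos = z≤n
sum-≥-length {suc k} f pos = +-mono-≤ (pos zero) (sum-≥-length (λ i → f (suc i)) (λ i → pos (suc i)))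

sum-<-length : ∀ {k} (f : Fin k → ℕ) → sum f < k → Σ (Fin k) λ i → f i ≡ 0
sum-<-length {suc k} f lt with f zero in f0
... | zero  = zero , f0
... | suc a with i , fi ← sum-<-length (λ i → f (suc i)) (≤-trans (s≤s (m≤n+m _ a)) (≤-pred lt)) = suc i , fi

sum-drop : ∀ {k} (h f : Fin k → ℕ) i0 → h i0 ≡ 0 → (∀ i → h i ≤ f i) → sum h + f i0 ≤ sum f
sum-drop h f zero h0 h≤f rewrite h0 =
  subst (_≤ f zero + sum (λ i → f (suc i))) (+-comm (f zero) _) (+-monoʳ-≤ (f zero) (sum-mono (λ i → h≤f (suc i))))
sum-drop h f (suc i0) h0 h≤f = ≤-trans (≤-reflexive (+-assoc (h zero) _ _))
  (+-mono-≤ (h≤f zero) (sum-drop (λ i → h (suc i)) (λ i → f (suc i)) i0 h0 (λ i → h≤f (suc i))))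

sum-next : ∀ {L} (g : Fin (suc L) → ℕ) → sum (λ i → g (next i)) ≡ sum g
sum-next {L} g = begin
  sum (λ i → g (next i))                               ≡⟨ sum-init-last (λ i → g (next i)) ⟩
  sum (λ i → g (next (inject₁ i))) + g (next (fromℕ L)) ≡⟨ cong₂ _+_ (sum-cong-≗ (λ i → cong g (next-prev (suc i)))) (cong g (next-prev zero)) ⟩
  sum (λ i → g (suc i)) + g zero                       ≡⟨ +-comm _ (g zero) ⟩
  sum g                                                ∎
  where open ≡-Reasoning

sum-prev : ∀ {L} (g : Fin (suc L) → ℕ) → sum (λ i → g (prev i)) ≡ sum g
sum-prev {L} g = trans (+-comm (g (fromℕ L)) _) (sym (sum-init-last g))

isZero : ∀ {k} → Fin k → ℕ
isZero zero    = 1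
isZero (suc _) = 0

sum-isZero : ∀ {L} → sum (isZero {suc L}) ≡ 1
sum-isZero {L} = cong suc (sum-replicate-zero L)

near : ∀ {L} → (Fin (suc L) → ℕ) → Fin (suc L) → ℕ
near g i = (isZero i + g (next i) + g (prev i)) ⊓ 1

near≤1 : ∀ {L} (g : Fin (suc L) → ℕ) i → near g i ≤ 1
near≤1 g i = m⊓n≤n _ 1

near-zero : ∀ {L} (g : Fin (suc L) → ℕ) → 1 ≤ near g zero
near-zero g = ⊓-glb (s≤s z≤n) ≤-refl

near-next : ∀ {L} (g : Fin (suc L) → ℕ) i → 1 ≤ g (next i) → 1 ≤ near g i
near-next g i pos = ⊓-glb (≤-trans pos (≤-trans (m≤n+m _ (isZero i)) (m≤m+n _ _))) ≤-refl

near-prev : ∀ {L} (g : Fin (suc L) → ℕ) i → 1 ≤ g (prev i) → 1 ≤ near g i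
near-prev g i pos = ⊓-glb (≤-trans pos (m≤n+m _ _)) ≤-refl

-- Each positive position makes at most its two neighbours near, plus the origin.
sum-near : ∀ {L} (g : Fin (suc L) → ℕ) → sum (near g) ≤ suc (sum g + sum g)
sum-near {L} g = begin
  sum (near g)                                                   ≤⟨ sum-mono (λ i → m⊓n≤m (isZero i + g (next i) + g (prev i)) 1) ⟩
  sum (λ i → isZero i + g (next i) + g (prev i))                 ≡⟨ ∑-distrib-+ (λ i → isZero i + g (next i)) (λ i → g (prev i)) ⟩
  sum (λ i → isZero i + g (next i)) + sum (λ i → g (prev i))     ≡⟨ cong₂ _+_ (∑-distrib-+ (isZero {suc L}) (λ i → g (next i))) (sum-prev g) ⟩
  sum (isZero {suc L}) + sum (λ i → g (next i)) + sum g                 ≡⟨ cong₂ (λ a b → a + b + sum g) (sum-isZero {L}) (sum-next g) ⟩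
  suc (sum g + sum g)                                            ∎
  where open ≤-Reasoning

move-offset : ∀ {n m} {B : Blocks n m} {p d q x} → Move B p d q x → Σ ℕ λ j → x ≡ stepN j d p
move-offset (stopped k j _ _ _) = j , refl
move-offset (noBlock j _ _)     = j , refl

module LowerBound {n m} (B : Blocks (suc n) (suc m)) where

  cell : Fin (suc n) → Fin (suc m) → ℕ
  cell i j = ind (B i j)

  rowBlocks : Fin (suc n) → ℕ
  rowBlocks r = sum (cell r)

  activeRow : Fin (suc n) → ℕ
  activeRow = near rowBlocks

  activeColBlocks : Fin (suc m) → ℕ
  activeColBlocks c = sum (λ r → activeRow r * cell r c)

  activeCol : Fin (suc m) → ℕ
  activeCol = near activeColBlocks

  Active : Pos (suc n) (suc m) → Set
  Active (r , c) = 1 ≤ activeRow r × 1 ≤ activeCol c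

  private
    cell-pos : ∀ {r c} → B r c ≡ true → 1 ≤ cell r c
    cell-pos b = subst (λ v → 1 ≤ ind v) (sym b) ≤-refl

    rowBlocks-pos : ∀ {r c} → B r c ≡ true → 1 ≤ rowBlocks r
    rowBlocks-pos {r} {c} b = ≤-trans (cell-pos b) (sum-point (cell r) c)

    activeColBlocks-pos : ∀ {r c} → 1 ≤ activeRow r → B r c ≡ true → 1 ≤ activeColBlocks c
    activeColBlocks-pos {r} {c} act b =
      ≤-trans (*-mono-≤ act (cell-pos b)) (sum-point (λ r → activeRow r * cell r c) r)

  -- A move keeps the row (horizontal) or the column (vertical) of its start,
  -- and stops next to a block, which makes the other coordinate active.
  active-move : ∀ {p d q x} → Active p → Move B p d q x → Active q
  active-move act (noBlock _ _ _) = act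
  active-move {p@(r , c)} {right} (ar , _) (stopped k _ _ b _) =
    ar′ , near-next activeColBlocks (proj₂ (stepN k right p)) (activeColBlocks-pos ar′ b)
    where ar′ = subst (λ z → 1 ≤ activeRow z) (sym (cong proj₁ (stepN-right r k c))) ar
  active-move {p@(r , c)} {left} (ar , _) (stopped k _ _ b _) =
    ar′ , near-prev activeColBlocks (proj₂ (stepN k left p)) (activeColBlocks-pos ar′ b)
    where ar′ = subst (λ z → 1 ≤ activeRow z) (sym (cong proj₁ (stepN-left r k c))) ar
  active-move {p@(r , c)} {down} (_ , ac) (stopped k _ _ b _) =
    near-next rowBlocks (proj₁ (stepN k down p)) (rowBlocks-pos b) , subst (λ z → 1 ≤ activeCol z) (sym (cong proj₂ (stepN-down c k r))) ac
  active-move {p@(r , c)} {up} (_ , ac) (stopped k _ _ b _) =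
    near-prev rowBlocks (proj₁ (stepN k up p)) (rowBlocks-pos b) , subst (λ z → 1 ≤ activeCol z) (sym (cong proj₂ (stepN-up c k r))) ac

  active-reach : ∀ {q} → Reach B q → Active q
  active-reach here          = near-zero rowBlocks , near-zero activeColBlocks
  active-reach (move d r mv) = active-move (active-reach r) mv

  -- A covered square lies on the line of a move from a reachable (active) square.
  covered-active : ∀ {x} → Covered B x → 1 ≤ activeRow (proj₁ x) ⊎ 1 ≤ activeCol (proj₂ x)
  covered-active ((r , c) , d , _ , reach , mv) with move-offset mv | active-reach reach
  ... | j , refl | ar , ac = on-line d
    where
      on-line : ∀ d → 1 ≤ activeRow (proj₁ (stepN j d (r , c))) ⊎ 1 ≤ activeCol (proj₂ (stepN j d (r , c)))
      on-line right = inj₁ (subst (λ z → 1 ≤ activeRow z) (sym (cong proj₁ (stepN-right r j c))) ar)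
      on-line left  = inj₁ (subst (λ z → 1 ≤ activeRow z) (sym (cong proj₁ (stepN-left r j c))) ar)
      on-line down  = inj₂ (subst (λ z → 1 ≤ activeCol z) (sym (cong proj₂ (stepN-down c j r))) ac)
      on-line up    = inj₂ (subst (λ z → 1 ≤ activeCol z) (sym (cong proj₂ (stepN-up c j r))) ac)

  activeBlocks : ℕ
  activeBlocks = sum activeColBlocks

  -- Blocks of active rows and of an inactive row i0 are disjoint.
  activeBlocks+inactiveRow : ∀ i0 → activeRow i0 ≡ 0 → activeBlocks + rowBlocks i0 ≤ numBlocks B
  activeBlocks+inactiveRow i0 inactive = begin
    activeBlocks + rowBlocks i0                             ≡⟨ cong (_+ rowBlocks i0) by-rows ⟩
    sum (λ r → activeRow r * rowBlocks r) + rowBlocks i0    ≤⟨ sum-drop _ rowBlocks i0 (cong (_* rowBlocks i0) inactive) weight≤1 ⟩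
    sum rowBlocks                                           ≡⟨ sym (numBlocks-sum B) ⟩
    numBlocks B                                             ∎
    where
      open ≤-Reasoning
      by-rows : activeBlocks ≡ sum (λ r → activeRow r * rowBlocks r)
      by-rows = trans (sym (∑-comm (λ r c → activeRow r * cell r c)))
                      (sum-cong-≗ (λ r → sym (*-distribˡ-sum (activeRow r) (cell r))))
      weight≤1 : ∀ r → activeRow r * rowBlocks r ≤ rowBlocks r
      weight≤1 r = subst (activeRow r * rowBlocks r ≤_) (*-identityˡ (rowBlocks r)) (*-monoˡ-≤ (rowBlocks r) (near≤1 rowBlocks r))

  inactiveRow-covered : (∀ x → ¬ Blocked B x → Covered B x) → ∀ i0 → activeRow i0 ≡ 0 → ∀ j → 1 ≤ cell i0 j + activeCol j
  inactiveRow-covered solves i0 inactive j with B i0 j in b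
  ... | true  = s≤s z≤n
  ... | false with covered-active (solves (i0 , j) (not-¬ b))
  ...   | inj₁ act = ⊥-elim (<⇒≱ act (≤-reflexive inactive))
  ...   | inj₂ act = act

  -- Either all n+1 rows are active, or some row is inactive and all its
  -- m+1 squares are blocks or lie in active columns; both give m ≤ 2·blocks.
  m≤twice-blocks : m ≤ n → (∀ x → ¬ Blocked B x → Covered B x) → m ≤ numBlocks B + numBlocks B
  m≤twice-blocks m≤n solves with sum activeRow <? suc n
  ... | no all-active = ≤-pred (begin
    suc m                                   ≤⟨ s≤s m≤n ⟩
    suc n                                   ≤⟨ ≮⇒≥ all-active ⟩
    sum activeRow                           ≤⟨ sum-near rowBlocks ⟩
    suc (sum rowBlocks + sum rowBlocks)     ≡⟨ cong (λ b → suc (b + b)) (sym (numBlocks-sum B)) ⟩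
    suc (numBlocks B + numBlocks B)         ∎)
    where open ≤-Reasoning
  ... | yes some-inactive with i0 , inactive ← sum-<-length activeRow some-inactive = ≤-pred (begin
    suc m                                               ≤⟨ sum-≥-length _ (inactiveRow-covered solves i0 inactive) ⟩
    sum (λ j → cell i0 j + activeCol j)                 ≡⟨ ∑-distrib-+ (cell i0) activeCol ⟩
    rowBlocks i0 + sum activeCol                        ≤⟨ +-monoʳ-≤ (rowBlocks i0) (sum-near activeColBlocks) ⟩
    rowBlocks i0 + suc (activeBlocks + activeBlocks)    ≡⟨ +-suc (rowBlocks i0) _ ⟩
    suc (rowBlocks i0 + (activeBlocks + activeBlocks))  ≡⟨ cong suc (sym (+-assoc (rowBlocks i0) activeBlocks activeBlocks)) ⟩
    suc (rowBlocks i0 + activeBlocks + activeBlocks)    ≤⟨ s≤s (+-mono-≤ disjoint (≤-trans (m≤n+m activeBlocks (rowBlocks i0)) disjoint)) ⟩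
    suc (numBlocks B + numBlocks B)                     ∎)
    where
      open ≤-Reasoning
      disjoint : rowBlocks i0 + activeBlocks ≤ numBlocks B
      disjoint = subst (_≤ numBlocks B) (+-comm activeBlocks (rowBlocks i0)) (activeBlocks+inactiveRow i0 inactive)

-- Column offsets of the strip pattern: rows 4j, 4j+1, 4j+2, 4j+3 use the
-- offsets 8j, 8j+4, 8j+1, 8j+5.
offset : ℕ → ℕ
offset 0 = 0
offset 1 = 4
offset 2 = 1
offset 3 = 5
offset (suc (suc (suc (suc t)))) = 8 + offset t

offset-period : ∀ j d → offset (j * 4 + d) ≡ j * 8 + offset d
offset-period zero    d = refl
offset-period (suc j) d = cong (8 +_) (offset-period j d)

offset⁻¹ : ℕ → ℕ
offset⁻¹ 0 = 0
offset⁻¹ 1 = 2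
offset⁻¹ 4 = 1
offset⁻¹ 5 = 3
offset⁻¹ (suc (suc (suc (suc (suc (suc (suc (suc v)))))))) = 4 + offset⁻¹ v
offset⁻¹ _ = 0

offset⁻¹-offset : ∀ t → offset⁻¹ (offset t) ≡ t
offset⁻¹-offset 0 = refl
offset⁻¹-offset 1 = refl
offset⁻¹-offset 2 = refl
offset⁻¹-offset 3 = refl
offset⁻¹-offset (suc (suc (suc (suc t)))) = cong (4 +_) (offset⁻¹-offset t)

offset-injective : ∀ {t t′} → offset t ≡ offset t′ → t ≡ t′
offset-injective {t} {t′} eq = trans (sym (offset⁻¹-offset t)) (trans (cong offset⁻¹ eq) (offset⁻¹-offset t′))

offset-bound : ∀ U t → t < U * 4 → offset t + 3 ≤ U * 8
offset-bound (suc U) 0 _ = s≤s (s≤s (s≤s z≤n))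
offset-bound (suc U) 1 _ = s≤s (s≤s (s≤s (s≤s (s≤s (s≤s (s≤s z≤n))))))
offset-bound (suc U) 2 _ = s≤s (s≤s (s≤s (s≤s z≤n)))
offset-bound (suc U) 3 _ = s≤s (s≤s (s≤s (s≤s (s≤s (s≤s (s≤s (s≤s z≤n)))))))
offset-bound (suc U) (suc (suc (suc (suc t)))) (s≤s (s≤s (s≤s (s≤s t<)))) =
  +-monoʳ-≤ 8 (offset-bound U t t<)

lower-bound : ∀ {n m} → m ≤ n → (B : Blocks (suc n) (suc m)) → IsSolution B → ⌈ m /2⌉ ≤ numBlocks B
lower-bound m≤n B (_ , solves) = subst (_ ≤_) (sym (n≡⌈n+n/2⌉ (numBlocks B)))
                                    (⌈n/2⌉-mono (LowerBound.m≤twice-blocks B m≤n solves))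

count-equal : ∀ {N} c → sum (λ (j : Fin N) → ind (toℕ j ≡ᵇ c)) ≤ 1
count-equal {zero}  c       = z≤n
count-equal {suc N} zero    = ≤-reflexive (cong suc (sum-replicate-zero N))
count-equal {suc N} (suc c) = count-equal {N} c

count-below : ∀ {N} k → sum (λ (i : Fin N) → ind (toℕ i <ᵇ k)) ≤ k
count-below {zero}  k       = z≤n
count-below {suc N} zero    = ≤-reflexive (sum-replicate-zero N)
count-below {suc N} (suc k) = s≤s (count-below {N} k)

module Staircase (n m k : ℕ) (col : ℕ → ℕ)
  (col< : ∀ t → t < k → col t < suc m)
  (col-inj : ∀ t t′ → t < k → t′ < k → col t ≡ col t′ → t ≡ t′)
  (k≤rows : k ≤ suc n)
  (start-free : 0 < k → 0 < col 0) where

  B : Blocks (suc n) (suc m)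
  B i j = (toℕ i <ᵇ k) ∧ (toℕ j ≡ᵇ col (toℕ i))

  block-at : ∀ {i j} → B i j ≡ true → toℕ i < k × toℕ j ≡ col (toℕ i)
  block-at {i} {j} b with Equivalence.to T-∧ (Equivalence.from T-≡ b)
  ... | i<k , j≡ = <ᵇ⇒< (toℕ i) k i<k , ≡ᵇ⇒≡ (toℕ j) _ j≡

  block-placed : ∀ {i j} → toℕ i < k → toℕ j ≡ col (toℕ i) → B i j ≡ true
  block-placed {i} {j} i<k j≡ = Equivalence.to T-≡ (Equivalence.from T-∧ (<⇒<ᵇ i<k , ≡⇒≡ᵇ (toℕ j) _ j≡))

  start-unblocked : ¬ Blocked B start
  start-unblocked b with block-at {zero} {zero} b
  ... | 0<k , 0≡col0 = <⇒≢ (start-free 0<k) 0≡col0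

  numBlocks≤k : numBlocks B ≤ k
  numBlocks≤k = begin
    numBlocks B                                 ≡⟨ numBlocks-sum B ⟩
    sum (λ i → sum (λ j → ind (B i j)))         ≤⟨ sum-mono row≤ ⟩
    sum (λ (i : Fin (suc n)) → ind (toℕ i <ᵇ k)) ≤⟨ count-below {suc n} k ⟩
    k                                           ∎
    where
      open ≤-Reasoning
      row≤ : ∀ i → sum (λ j → ind (B i j)) ≤ ind (toℕ i <ᵇ k)
      row≤ i with toℕ i <ᵇ k
      ... | true  = count-equal {suc m} (col (toℕ i))
      ... | false = ≤-reflexive (sum-replicate-zero (suc m))

  open TorusLines B start-unblocked

  RowReached : ℕ → Set
  RowReached t = ∀ (r : Fin (suc n)) → toℕ r ≡ t → Σ (Fin (suc m)) λ x → Reach B (r , x)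

  ColReached : ℕ → Set
  ColReached c = ∀ (j : Fin (suc m)) → toℕ j ≡ c → Σ (Fin (suc n)) λ x → Reach B (x , j)

  row0-reached : RowReached 0
  row0-reached zero    _ = zero , here
  row0-reached (suc r) ()

  col0-reached : ColReached 0
  col0-reached zero    _ = zero , here
  col0-reached (suc j) ()

  private
    rowFin : ∀ t → t < k → Fin (suc n)
    rowFin t t<k = fromℕ< (≤-trans t<k k≤rows)

    colFin : ∀ t → t < k → Fin (suc m)
    colFin t t<k = fromℕ< (col< t t<k)

    toℕ-rowFin : ∀ t t<k → toℕ (rowFin t t<k) ≡ t
    toℕ-rowFin t t<k = toℕ-fromℕ< _

    toℕ-colFin : ∀ t t<k → toℕ (colFin t t<k) ≡ col t
    toℕ-colFin t t<k = toℕ-fromℕ< _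

    block-of : ∀ t t<k → B (rowFin t t<k) (colFin t t<k) ≡ true
    block-of t t<k = block-placed (subst (_< k) (sym (toℕ-rowFin t t<k)) t<k)
                                 (trans (toℕ-colFin t t<k) (cong col (sym (toℕ-rowFin t t<k))))

    row-only : ∀ t t<k → RowOnlyBlock (rowFin t t<k) (colFin t t<k)
    row-only t t<k = block-of t t<k , λ j b →
      toℕ-injective (trans (proj₂ (block-at b)) (trans (cong col (toℕ-rowFin t t<k)) (sym (toℕ-colFin t t<k))))

    col-only : ∀ t t<k → ColOnlyBlock (colFin t t<k) (rowFin t t<k)
    col-only t t<k = block-of t t<k , λ i b → let (i<k , i≡) = block-at b in
      toℕ-injective (trans (col-inj (toℕ i) t i<k t<k (trans (sym i≡) (toℕ-colFin t t<k))) (sym (toℕ-rowFin t t<k)))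

    col-reached : ∀ {c x} (j₀ : Fin (suc m)) → Reach B (x , j₀) → toℕ j₀ ≡ c → ColReached c
    col-reached {x = x} j₀ r j₀≡ j j≡ = x , subst (λ z → Reach B (x , z)) (toℕ-injective (trans j₀≡ (sym j≡))) r

    row-reached : ∀ {t x} (i₀ : Fin (suc n)) → Reach B (i₀ , x) → toℕ i₀ ≡ t → RowReached t
    row-reached {x = x} i₀ r i₀≡ i i≡ = x , subst (λ z → Reach B (z , x)) (toℕ-injective (trans i₀≡ (sym i≡))) r

    in-row : ∀ t t<k → RowReached t → Σ (Fin (suc m)) λ x → Reach B (rowFin t t<k , x)
    in-row t t<k reached = reached (rowFin t t<k) (toℕ-rowFin t t<k)

    in-col : ∀ t t<k → ColReached (col t) → Σ (Fin (suc n)) λ x → Reach B (x , colFin t t<k)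
    in-col t t<k reached = reached (colFin t t<k) (toℕ-colFin t t<k)

    toℕ-prev-colFin : ∀ t t<k → toℕ (prev (colFin t t<k)) ≡ (col t + m) % suc m
    toℕ-prev-colFin t t<k = trans (toℕ-prev (colFin t t<k)) (cong (λ z → (z + m) % suc m) (toℕ-colFin t t<k))

  col-right : ∀ t c → t < k → RowReached t → col t ≡ c → suc c < suc m → ColReached (suc c)
  col-right t c t<k reached refl lt with x , r ← in-row t t<k reached =
    col-reached _ (reach-right-of r (row-only t t<k))
      (trans (toℕ-next (colFin t t<k)) (trans (cong (λ z → suc z % suc m) (toℕ-colFin t t<k)) (m<n⇒m%n≡m lt)))

  col-left : ∀ t c → t < k → RowReached t → col t ≡ suc c → ColReached c
  col-left t c t<k reached col≡ with x , r ← in-row t t<k reached =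
    col-reached _ (reach-left-of r (row-only t t<k)) (begin
      toℕ (prev (colFin t t<k))  ≡⟨ toℕ-prev-colFin t t<k ⟩
      (col t + m) % suc m        ≡⟨ cong (λ z → (z + m) % suc m) col≡ ⟩
      (suc c + m) % suc m        ≡⟨ cong (_% suc m) (sym (+-suc c m)) ⟩
      (c + suc m) % suc m        ≡⟨ [m+n]%n≡m%n c (suc m) ⟩
      c % suc m                  ≡⟨ m<n⇒m%n≡m (<-trans (n<1+n c) (subst (_< suc m) col≡ (col< t t<k))) ⟩
      c                          ∎)
    where open ≡-Reasoning

  -- left of column 0 is the last column m
  col-wrap : ∀ t → t < k → RowReached t → col t ≡ 0 → ColReached m
  col-wrap t t<k reached col≡0 with x , r ← in-row t t<k reached =
    col-reached _ (reach-left-of r (row-only t t<k))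
      (trans (toℕ-prev-colFin t t<k) (trans (cong (λ z → (z + m) % suc m) col≡0) (m<n⇒m%n≡m ≤-refl)))

  -- (the row index suc t, when it exists, is not wrapped: it is below n + 1)
  row-below : ∀ t c → t < k → ColReached c → col t ≡ c → RowReached (suc t)
  row-below t c t<k reached refl i i≡ with x , r ← in-col t t<k reached =
    row-reached _ (reach-below r (col-only t t<k))
      (trans (toℕ-next (rowFin t t<k)) (trans (cong (λ z → suc z % suc n) (toℕ-rowFin t t<k))
             (m<n⇒m%n≡m (subst (_< suc n) i≡ (toℕ<n i))))) i i≡

  row-above : ∀ s c → suc s < k → ColReached c → col (suc s) ≡ c → RowReached s
  row-above s c s<k reached refl with x , r ← in-col (suc s) s<k reached =
    row-reached _ (reach-above r (col-only (suc s) s<k)) (begin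
      toℕ (prev (rowFin (suc s) s<k))        ≡⟨ toℕ-prev (rowFin (suc s) s<k) ⟩
      (toℕ (rowFin (suc s) s<k) + n) % suc n ≡⟨ cong (λ z → (z + n) % suc n) (toℕ-rowFin (suc s) s<k) ⟩
      (suc s + n) % suc n                    ≡⟨ cong (_% suc n) (sym (+-suc s n)) ⟩
      (s + suc n) % suc n                    ≡⟨ [m+n]%n≡m%n s (suc n) ⟩
      s % suc n                              ≡⟨ m<n⇒m%n≡m (<-trans (n<1+n s) (≤-trans s<k k≤rows)) ⟩
      s                                      ∎)
    where open ≡-Reasoning

  solution : (∀ c → c < suc m → ColReached c) → IsSolution B
  solution all-cols = start-unblocked , covered
    where
      covered : ∀ p → ¬ Blocked B p → Covered B p
      covered (i , c) free with all-cols (toℕ c) (toℕ<n c) c refl | any? (λ s → B s c ≟-Bool true)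
      ... | x , r | yes (s , b) = cover-column-one r (b , only) i free
        where only : ∀ i′ → B i′ c ≡ true → i′ ≡ s
              only i′ b′ with i′<k , c≡ ← block-at {i′} {c} b′ | s<k , c≡′ ← block-at {s} {c} b =
                toℕ-injective (col-inj _ _ i′<k s<k (trans (sym c≡) c≡′))
      ... | x , r | no none = cover-column-none r (λ i′ b′ → none (i′ , b′)) i

  Strip : ℕ → ℕ → Set
  Strip r c = 3 + r < k × (∀ d → d < 4 → col (d + r) ≡ offset d + suc c) × 6 + c < suc m

  private
    strip-row< : ∀ {r c} → Strip r c → ∀ d → d < 4 → d + r < k
    strip-row< {r} (3+r<k , _) d d<4 = ≤-<-trans (+-monoˡ-≤ r (≤-pred d<4)) 3+r<k

  -- Entering a strip at its first row, the robot enters its other rows and the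
  -- first row of the next strip: row r gives column c + 2, hence the rows r ± 1
  -- around the block of row r + 2; row r + 1 gives column c + 6, hence the rows
  -- r + 2 and r + 4 around the block of row r + 3; and so on.
  strip-rows : ∀ {r c} → Strip r c → RowReached r →
               RowReached (1 + r) × RowReached (2 + r) × RowReached (3 + r) × RowReached (4 + r)
  strip-rows {r} {c} S@(_ , cols , 6+c<) row0 = row1 , row2 , row3 , row4
    where
      c+2 : ColReached (2 + c)
      c+2 = col-right r (1 + c) (strip-row< S 0 z<s) row0 (cols 0 z<s) (≤-<-trans (+-monoˡ-≤ c (s≤s (s≤s z≤n))) 6+c<)
      row1 : RowReached (1 + r)
      row1 = row-above (1 + r) (2 + c) (strip-row< S 2 (s≤s (s≤s z<s))) c+2 (cols 2 (s≤s (s≤s z<s)))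
      row3 : RowReached (3 + r)
      row3 = row-below (2 + r) (2 + c) (strip-row< S 2 (s≤s (s≤s z<s))) c+2 (cols 2 (s≤s (s≤s z<s)))
      c+6 : ColReached (6 + c)
      c+6 = col-right (1 + r) (5 + c) (strip-row< S 1 (s≤s z<s)) row1 (cols 1 (s≤s z<s)) 6+c<
      row2 : RowReached (2 + r)
      row2 = row-above (2 + r) (6 + c) (strip-row< S 3 ≤-refl) c+6 (cols 3 ≤-refl)
      row4 : RowReached (4 + r)
      row4 = row-below (3 + r) (6 + c) (strip-row< S 3 ≤-refl) c+6 (cols 3 ≤-refl)

  -- Once its four rows are entered, the strip's columns c, …, c + 7 (as far
  -- as they exist) are entered beside the blocks at c + 1, c + 5, c + 2, c + 6.
  strip-columns : ∀ {r c} → Strip r c → (∀ d → d < 4 → RowReached (d + r)) →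
                  ∀ d → d < 8 → d + c < suc m → ColReached (d + c)
  strip-columns {r} {c} S@(_ , cols , _) rows = columns
    where
      left-of : ∀ d → d < 4 → ∀ {x} → offset d + suc c ≡ suc x → ColReached x
      left-of d d<4 eq = col-left (d + r) _ (strip-row< S d d<4) (rows d d<4) (trans (cols d d<4) eq)
      right-of : ∀ d → d < 4 → suc (offset d + suc c) < suc m → ColReached (suc (offset d + suc c))
      right-of d d<4 = col-right (d + r) _ (strip-row< S d d<4) (rows d d<4) (cols d d<4)
      columns : ∀ d → d < 8 → d + c < suc m → ColReached (d + c)
      columns 0 _ _  = left-of 0 z<s refl
      columns 1 _ _  = left-of 2 (s≤s (s≤s z<s)) refl
      columns 2 _ lt = right-of 0 z<s lt
      columns 3 _ lt = right-of 2 (s≤s (s≤s z<s)) lt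
      columns 4 _ _  = left-of 1 (s≤s z<s) refl
      columns 5 _ _  = left-of 3 ≤-refl refl
      columns 6 _ lt = right-of 1 (s≤s z<s) lt
      columns 7 _ lt = right-of 3 ≤-refl lt
      columns (suc (suc (suc (suc (suc (suc (suc (suc _)))))))) (s≤s (s≤s (s≤s (s≤s (s≤s (s≤s (s≤s (s≤s ())))))))) _

  strip : ∀ {r c} → Strip r c → RowReached r →
          (∀ d → d < 8 → d + c < suc m → ColReached (d + c)) × RowReached (4 + r)
  strip {r} S row0 with row1 , row2 , row3 , row4 ← strip-rows S row0 = strip-columns S rows , row4
    where
      rows : ∀ d → d < 4 → RowReached (d + r)
      rows 0 _ = row0
      rows 1 _ = row1
      rows 2 _ = row2
      rows 3 _ = row3
      rows (suc (suc (suc (suc _)))) (s≤s (s≤s (s≤s (s≤s ()))))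

  strips : ∀ h c U → (∀ j → j < U → Strip (h + j * 4) (c + j * 8)) → RowReached h →
           (∀ x → c ≤ x → x < c + U * 8 → x < suc m → ColReached x) × RowReached (h + U * 4)
  strips h c zero _ row-h =
    (λ x c≤x x<c _ → ⊥-elim (<⇒≱ (subst (x <_) (+-identityʳ c) x<c) c≤x)) ,
    subst RowReached (sym (+-identityʳ h)) row-h
  strips h c (suc U) strip-at row-h = columns , subst RowReached (shift h U) (proj₂ last)
    where
      earlier : (∀ x → c ≤ x → x < c + U * 8 → x < suc m → ColReached x) × RowReached (h + U * 4)
      earlier = strips h c U (λ j j<U → strip-at j (<-trans j<U (n<1+n U))) row-h
      last : (∀ d → d < 8 → d + (c + U * 8) < suc m → ColReached (d + (c + U * 8))) × RowReached (4 + (h + U * 4))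
      last = strip (strip-at U (n<1+n U)) (proj₂ earlier)
      shift : ∀ h U → 4 + (h + U * 4) ≡ h + suc U * 4
      shift = solve-∀
      widen : ∀ c U → c + suc U * 8 ≡ c + U * 8 + 8
      widen = solve-∀
      columns : ∀ x → c ≤ x → x < c + suc U * 8 → x < suc m → ColReached x
      columns x c≤x x< x<m with x <? c + U * 8
      ... | yes lt = proj₁ earlier x c≤x lt x<m
      ... | no ge = subst ColReached (m∸n+n≡m (≮⇒≥ ge))
                      (proj₁ last (x ∸ (c + U * 8)) (m<n+o⇒m∸n<o x (c + U * 8) (subst (x <_) (widen c U) x<))
                                  (subst (_< suc m) (sym (m∸n+n≡m (≮⇒≥ ge))) x<m))

Small : ℕ → ℕ → Set
Small n m = Σ (Blocks (suc n) (suc m)) λ B → IsSolution B × numBlocks B ≤ ⌈ m /2⌉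

-- The strip pattern started at row 0 and column c, with U strips followed by
-- e tail rows: row t holds its block in column offset t + c + 1, reduced
-- modulo the number of columns m + 1 (only a tail row may wrap, to column 0).
module TailScheme (n m : ℕ) (m≤n : m ≤ n) (c U e r : ℕ) (c≤2 : c ≤ 2) (c≤1+r : c ≤ suc r)
  (M≡ : suc m ≡ U * 8 + r) (k≡ : ⌈ m /2⌉ ≡ U * 4 + e)
  (tail-fits : ∀ e′ → e′ < e → offset e′ + suc c ≤ r) (1+c<M : suc c < suc m) where

  M k : ℕ
  M = suc m
  k = ⌈ m /2⌉

  col : ℕ → ℕ
  col t = (offset t + suc c) % M

  private
    open ≤-Reasoning

    value≤M : ∀ t → t < k → offset t + suc c ≤ M
    value≤M t t<k with t <? U * 4
    ... | yes t<U4 = begin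
      offset t + suc c   ≤⟨ +-monoʳ-≤ (offset t) (s≤s c≤2) ⟩
      offset t + 3       ≤⟨ offset-bound U t t<U4 ⟩
      U * 8              ≤⟨ m≤m+n (U * 8) r ⟩
      U * 8 + r          ≡⟨ sym M≡ ⟩
      M                  ∎
    ... | no t≮U4 = begin
      offset t + suc c                       ≡⟨ cong (λ z → offset z + suc c) (sym t≡) ⟩
      offset (U * 4 + e′) + suc c            ≡⟨ cong (_+ suc c) (offset-period U e′) ⟩
      U * 8 + offset e′ + suc c              ≡⟨ +-assoc (U * 8) (offset e′) (suc c) ⟩
      U * 8 + (offset e′ + suc c)            ≤⟨ +-monoʳ-≤ (U * 8) (tail-fits e′ e′<e) ⟩
      U * 8 + r                              ≡⟨ sym M≡ ⟩
      M                                      ∎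
      where
        e′ : ℕ
        e′ = t ∸ U * 4
        t≡ : U * 4 + e′ ≡ t
        t≡ = m+[n∸m]≡n (≮⇒≥ t≮U4)
        e′<e : e′ < e
        e′<e = +-cancelˡ-< (U * 4) e′ e (subst₂ _<_ (sym t≡) k≡ t<k)

    col-inj : ∀ t t′ → t < k → t′ < k → col t ≡ col t′ → t ≡ t′
    col-inj t t′ t<k t′<k eq = offset-injective (+-cancelʳ-≡ (suc c) _ _
      (%-injective M (positive t) (value≤M t t<k) (positive t′) (value≤M t′ t′<k) eq))
      where positive : ∀ t → 0 < offset t + suc c
            positive t = subst (0 <_) (sym (+-suc (offset t) c)) z<s

    k≤rows : k ≤ suc n
    k≤rows = ≤-trans (⌈n/2⌉≤n m) (≤-trans m≤n (n≤1+n n))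

    start-free : 0 < k → 0 < col 0
    start-free _ = subst (0 <_) (sym (m<n⇒m%n≡m 1+c<M)) z<s

  open Staircase n m k col (λ t _ → m%n<n (offset t + suc c) M) col-inj k≤rows start-free public

  col-at : ∀ j d → col (d + j * 4) ≡ (offset d + suc (c + j * 8)) % M
  col-at j d = cong (_% M) (begin-equality
    offset (d + j * 4) + suc c      ≡⟨ cong (λ z → offset z + suc c) (+-comm d (j * 4)) ⟩
    offset (j * 4 + d) + suc c      ≡⟨ cong (_+ suc c) (offset-period j d) ⟩
    j * 8 + offset d + suc c        ≡⟨ rearrange (j * 8) (offset d) c ⟩
    offset d + suc (c + j * 8)      ∎)
    where rearrange : ∀ a b c → a + b + suc c ≡ b + suc (c + a)
          rearrange = solve-∀

  private
    offset<6 : ∀ d → d < 4 → offset d ≤ 5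
    offset<6 0 _ = z≤n
    offset<6 1 _ = s≤s (s≤s (s≤s (s≤s z≤n)))
    offset<6 2 _ = s≤s z≤n
    offset<6 3 _ = ≤-refl
    offset<6 (suc (suc (suc (suc _)))) (s≤s (s≤s (s≤s (s≤s ()))))

    strip-at : ∀ j → j < U → Strip (j * 4) (c + j * 8)
    strip-at j j<U = rows , cols , room
      where
        rows : 3 + j * 4 < k
        rows = begin
          suc j * 4     ≤⟨ *-monoˡ-≤ 4 j<U ⟩
          U * 4         ≤⟨ m≤m+n (U * 4) e ⟩
          U * 4 + e     ≡⟨ sym k≡ ⟩
          k             ∎
        room : 6 + (c + j * 8) < M
        room = begin
          7 + (c + j * 8)        ≤⟨ +-monoʳ-≤ 7 (+-monoˡ-≤ (j * 8) c≤1+r) ⟩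
          7 + (suc r + j * 8)    ≡⟨ rearrange r j ⟩
          suc j * 8 + r          ≤⟨ +-monoˡ-≤ r (*-monoˡ-≤ 8 j<U) ⟩
          U * 8 + r              ≡⟨ sym M≡ ⟩
          M                      ∎
          where rearrange : ∀ r j → 7 + (suc r + j * 8) ≡ suc j * 8 + r
                rearrange = solve-∀
        cols : ∀ d → d < 4 → col (d + j * 4) ≡ offset d + suc (c + j * 8)
        cols d d<4 = trans (col-at j d) (m<n⇒m%n≡m (≤-<-trans (+-monoˡ-≤ (suc (c + j * 8)) (offset<6 d d<4)) room))

  columns-of-strips : ∀ x → c ≤ x → x < c + U * 8 → x < M → ColReached x
  columns-of-strips = proj₁ (strips 0 c U strip-at row0-reached)

  tail-row : RowReached (U * 4)
  tail-row = proj₂ (strips 0 c U strip-at row0-reached)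

  tail-row< : ∀ e′ → e′ < e → e′ + U * 4 < k
  tail-row< e′ e′<e = subst₂ _<_ (+-comm (U * 4) e′) (sym k≡) (+-monoʳ-< (U * 4) e′<e)

  all-columns : (∀ x → 0 < x → x < c → ColReached x) →
                (∀ d → d + (c + U * 8) < M → ColReached (d + (c + U * 8))) →
                ∀ x → x < M → ColReached x
  all-columns low high x x<M with x ≟ 0 | x <? c | x <? c + U * 8
  ... | yes refl | _ | _ = col0-reached
  ... | no x≢0 | yes x<c | _ = low x (n≢0⇒n>0 x≢0) x<c
  ... | no _ | no x≮c | yes x<V = columns-of-strips x (≮⇒≥ x≮c) x<V x<M
  ... | no _ | no _ | no x≮V = subst ColReached x≡ (high (x ∸ (c + U * 8)) (subst (_< M) (sym x≡) x<M))
    where x≡ : x ∸ (c + U * 8) + (c + U * 8) ≡ x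
          x≡ = m∸n+n≡m (≮⇒≥ x≮V)

  from-all-columns : (∀ x → x < M → ColReached x) → Small n m
  from-all-columns all-cols = B , solution all-cols , numBlocks≤k

-- m + 1 = 8U + r with r ≤ 1: the strips alone suffice.
strips-only : ∀ n m U r → m ≤ n → 5 ≤ m → r ≤ 1 → suc m ≡ U * 8 + r → ⌈ m /2⌉ ≡ U * 4 + 0 → Small n m
strips-only n m U r m≤n 5≤m r≤1 M≡ k≡ = from-all-columns (all-columns none beyond)
  where
    open TailScheme n m m≤n 1 U 0 r (s≤s z≤n) (s≤s z≤n) M≡ k≡ (λ _ ()) (s≤s (≤-trans (s≤s (s≤s z≤n)) 5≤m))
    none : ∀ x → 0 < x → x < 1 → ColReached x
    none x 0<x x<1 = ⊥-elim (<⇒≱ 0<x (≤-pred x<1))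
    beyond : ∀ d → d + (1 + U * 8) < suc m → ColReached (d + (1 + U * 8))
    beyond d lt = ⊥-elim (<⇒≱ lt (begin
      suc m           ≡⟨ M≡ ⟩
      U * 8 + r       ≤⟨ +-monoʳ-≤ (U * 8) r≤1 ⟩
      U * 8 + 1       ≡⟨ +-comm (U * 8) 1 ⟩
      1 + U * 8       ≤⟨ m≤n+m _ d ⟩
      d + (1 + U * 8) ∎))
      where open ≤-Reasoning

-- m + 1 = 8U + c + 1 with c ∈ {1, 2}: one tail row, whose block sits in column 0,
-- reaches the columns m and 1 on either side of it.
module OneTail (n m U c : ℕ) (m≤n : m ≤ n) (5≤m : 5 ≤ m) (c≤2 : c ≤ 2)
  (M≡ : suc m ≡ U * 8 + suc c) (k≡ : ⌈ m /2⌉ ≡ U * 4 + 1) where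

  private
    -- the tail row aims at column c + 1 + 8U = m + 1, i.e. column 0
    fits : ∀ e′ → e′ < 1 → offset e′ + suc c ≤ suc c
    fits 0 _ = ≤-refl
    fits (suc _) (s≤s ())
    open TailScheme n m m≤n c U 1 (suc c) c≤2 (≤-trans (n≤1+n c) (n≤1+n _)) M≡ k≡ fits
                    (s≤s (≤-trans (s≤s c≤2) (≤-trans (s≤s (s≤s (s≤s z≤n))) 5≤m)))
    V : ℕ
    V = c + U * 8
    m≡V : m ≡ V
    m≡V = suc-injective (trans M≡ (trans (+-suc (U * 8) c) (cong suc (+-comm (U * 8) c))))
    tail<k : U * 4 < k
    tail<k = tail-row< 0 z<s
    wraps : col (U * 4) ≡ 0
    wraps = trans (col-at U 0) (trans (cong (λ z → suc z % suc m) (sym m≡V)) (n%n≡0 (suc m)))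
    low : ∀ x → 0 < x → x < c → ColReached x
    low 0 () _
    low 1 _ _ = col-right (U * 4) 0 tail<k tail-row wraps (s≤s (≤-trans (s≤s z≤n) 5≤m))
    low (suc (suc x)) _ x<c = ⊥-elim (<⇒≱ x<c (≤-trans c≤2 (s≤s (s≤s z≤n))))
    high : ∀ d → d + V < suc m → ColReached (d + V)
    high 0 _ = subst ColReached m≡V (col-wrap (U * 4) tail<k tail-row wraps)
    high (suc d) lt = ⊥-elim (<⇒≱ lt (s≤s (subst (_≤ d + V) (sym m≡V) (m≤n+m V d))))

  small : Small n m
  small = from-all-columns (all-columns low high)

-- m + 1 = 8U + c + 5 with c ∈ {1, 2}: three tail rows aiming at the columns
-- V + 1, 0 and V + 2 (V = c + 8U) enter the columns V, …, V + 4 = m and 1.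
module ThreeTail (n m U c : ℕ) (m≤n : m ≤ n) (5≤m : 5 ≤ m) (c≤2 : c ≤ 2)
  (M≡ : suc m ≡ U * 8 + (5 + c)) (k≡ : ⌈ m /2⌉ ≡ U * 4 + 3) where

  private
    fits : ∀ e′ → e′ < 3 → offset e′ + suc c ≤ 5 + c
    fits 0 _ = s≤s (m≤n+m c 4)
    fits 1 _ = ≤-refl
    fits 2 _ = s≤s (s≤s (m≤n+m c 3))
    fits (suc (suc (suc _))) (s≤s (s≤s (s≤s ())))
    open TailScheme n m m≤n c U 3 (5 + c) c≤2 (≤-trans (n≤1+n c) (m≤n+m (suc c) 5)) M≡ k≡ fits
                    (s≤s (≤-trans (s≤s c≤2) (≤-trans (s≤s (s≤s (s≤s z≤n))) 5≤m)))
    V : ℕ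
    V = c + U * 8
    m≡ : m ≡ 4 + V
    m≡ = suc-injective (trans M≡ (rearrange U c))
      where rearrange : ∀ U c → U * 8 + (5 + c) ≡ 5 + (c + U * 8)
            rearrange = solve-∀
    below-M : ∀ {x} → x ≤ 4 → x + V < suc m
    below-M {x} x≤4 = s≤s (subst (x + V ≤_) (sym m≡) (+-monoˡ-≤ V x≤4))
    T0 T1 T2 : ℕ
    T0 = 0 + U * 4
    T1 = 1 + U * 4
    T2 = 2 + U * 4
    T0<k : T0 < k
    T0<k = tail-row< 0 (s≤s z≤n)
    T1<k : T1 < k
    T1<k = tail-row< 1 (s≤s (s≤s z≤n))
    T2<k : T2 < k
    T2<k = tail-row< 2 (s≤s (s≤s (s≤s z≤n)))
    col-T0 : col T0 ≡ 1 + V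
    col-T0 = trans (col-at U 0) (m<n⇒m%n≡m (below-M (s≤s z≤n)))
    col-T1 : col T1 ≡ 0
    col-T1 = trans (col-at U 1) (trans (cong (λ z → suc z % suc m) (sym m≡)) (n%n≡0 (suc m)))
    col-T2 : col T2 ≡ 2 + V
    col-T2 = trans (col-at U 2) (m<n⇒m%n≡m (below-M (s≤s (s≤s z≤n))))
    c-V : ColReached V
    c-V = col-left T0 V T0<k tail-row col-T0
    c-V+2 : ColReached (2 + V)
    c-V+2 = col-right T0 (1 + V) T0<k tail-row col-T0 (below-M (s≤s (s≤s z≤n)))
    row-T1 : RowReached T1
    row-T1 = row-above T1 (2 + V) T2<k c-V+2 col-T2
    c-m : ColReached m
    c-m = col-wrap T1 T1<k row-T1 col-T1
    c-1 : ColReached 1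
    c-1 = col-right T1 0 T1<k row-T1 col-T1 (s≤s (≤-trans (s≤s z≤n) 5≤m))
    row-T2 : RowReached T2
    row-T2 = row-below T1 0 T1<k col0-reached col-T1
    c-V+1 : ColReached (1 + V)
    c-V+1 = col-left T2 (1 + V) T2<k row-T2 col-T2
    c-V+3 : ColReached (3 + V)
    c-V+3 = col-right T2 (2 + V) T2<k row-T2 col-T2 (below-M (s≤s (s≤s (s≤s z≤n))))
    low : ∀ x → 0 < x → x < c → ColReached x
    low 0 () _
    low 1 _ _ = c-1
    low (suc (suc x)) _ x<c = ⊥-elim (<⇒≱ x<c (≤-trans c≤2 (s≤s (s≤s z≤n))))
    high : ∀ d → d + V < suc m → ColReached (d + V)
    high 0 _ = c-V
    high 1 _ = c-V+1
    high 2 _ = c-V+2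
    high 3 _ = c-V+3
    high 4 _ = subst ColReached m≡ c-m
    high (suc (suc (suc (suc (suc d))))) lt = ⊥-elim (<⇒≱ lt (s≤s (subst (_≤ 4 + d + V) (sym m≡) (+-monoˡ-≤ V (m≤m+n 4 d)))))

  small : Small n m
  small = from-all-columns (all-columns low high)

-- m = w + 3 with w ∈ {8U, 8U + 1}, U ≥ 1: two head rows aiming at the columns
-- w + 1 and w + 2, followed by U strips started at row 2 and column 1.
module HeadScheme (n m U w : ℕ) (m≤n : m ≤ n) (1≤U : 1 ≤ U) (m≡ : m ≡ 3 + w)
  (8U≤w : U * 8 ≤ w) (w≤8U+1 : w ≤ U * 8 + 1) (k≡ : ⌈ m /2⌉ ≡ U * 4 + 2) where

  M k : ℕ
  M = suc m
  k = ⌈ m /2⌉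

  col : ℕ → ℕ
  col 0 = 1 + w
  col 1 = 2 + w
  col (suc (suc t)) = 2 + offset t

  private
    open ≤-Reasoning

    M≡ : M ≡ 4 + w
    M≡ = cong suc m≡

    strip-col< : ∀ s → suc (suc s) < k → 2 + offset s < 1 + w
    strip-col< s lt = s≤s (begin
      2 + offset s   ≤⟨ n≤1+n _ ⟩
      3 + offset s   ≡⟨ +-comm 3 (offset s) ⟩
      offset s + 3   ≤⟨ offset-bound U s s<U4 ⟩
      U * 8          ≤⟨ 8U≤w ⟩
      w              ∎)
      where s<U4 : s < U * 4
            s<U4 = +-cancelʳ-< 2 s (U * 4) (subst₂ _<_ (+-comm 2 s) k≡ lt)

    1+w<M : 1 + w < M
    1+w<M = subst (2 + w ≤_) (sym M≡) (+-monoˡ-≤ w (s≤s (s≤s z≤n)))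

    col< : ∀ t → t < k → col t < M
    col< 0 _ = 1+w<M
    col< 1 _ = subst (3 + w ≤_) (sym M≡) (n≤1+n _)
    col< (suc (suc s)) lt = <-trans (strip-col< s lt) 1+w<M

    col-inj : ∀ t t′ → t < k → t′ < k → col t ≡ col t′ → t ≡ t′
    col-inj 0 0 _ _ _ = refl
    col-inj 1 1 _ _ _ = refl
    col-inj 0 1 _ _ eq = ⊥-elim (1+n≢n (sym eq))
    col-inj 1 0 _ _ eq = ⊥-elim (1+n≢n eq)
    col-inj 0 (suc (suc s)) _ lt eq = ⊥-elim (<⇒≢ (strip-col< s lt) (sym eq))
    col-inj 1 (suc (suc s)) _ lt eq = ⊥-elim (<⇒≢ (<-trans (strip-col< s lt) (n<1+n _)) (sym eq))
    col-inj (suc (suc s)) 0 lt _ eq = ⊥-elim (<⇒≢ (strip-col< s lt) eq)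
    col-inj (suc (suc s)) 1 lt _ eq = ⊥-elim (<⇒≢ (<-trans (strip-col< s lt) (n<1+n _)) eq)
    col-inj (suc (suc s)) (suc (suc s′)) _ _ eq = cong (2 +_) (offset-injective (+-cancelˡ-≡ 2 _ _ eq))

    k≤rows : k ≤ suc n
    k≤rows = ≤-trans (⌈n/2⌉≤n m) (≤-trans m≤n (n≤1+n n))

  open Staircase n m k col col< col-inj k≤rows (λ _ → z<s) public

  private
    strip-at : ∀ j → j < U → Strip (2 + j * 4) (1 + j * 8)
    strip-at j j<U = rows , cols , room
      where
        rows : 3 + (2 + j * 4) < k
        rows = subst₂ _≤_ (solve4 j) (sym k≡) (+-monoˡ-≤ 2 (*-monoˡ-≤ 4 j<U))
          where solve4 : ∀ j → suc j * 4 + 2 ≡ 4 + (2 + j * 4)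
                solve4 = solve-∀
        room : 6 + (1 + j * 8) < M
        room = begin
          8 + j * 8   ≤⟨ *-monoˡ-≤ 8 j<U ⟩
          U * 8       ≤⟨ 8U≤w ⟩
          w           ≤⟨ m≤n+m w 4 ⟩
          4 + w       ≡⟨ sym M≡ ⟩
          M           ∎
        cols : ∀ d → d < 4 → col (d + (2 + j * 4)) ≡ offset d + suc (1 + j * 8)
        cols d _ = begin-equality
          col (d + (2 + j * 4))          ≡⟨ cong col (+-suc d (suc (j * 4))) ⟩
          col (suc (d + suc (j * 4)))    ≡⟨ cong (λ z → col (suc z)) (+-suc d (j * 4)) ⟩
          2 + offset (d + j * 4)         ≡⟨ cong (λ z → 2 + offset z) (+-comm d (j * 4)) ⟩
          2 + offset (j * 4 + d)         ≡⟨ cong (2 +_) (offset-period j d) ⟩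
          2 + (j * 8 + offset d)         ≡⟨ rearrange j (offset d) ⟩
          offset d + suc (1 + j * 8)     ∎
          where rearrange : ∀ j o → 2 + (j * 8 + o) ≡ o + suc (1 + j * 8)
                rearrange = solve-∀

    0<k : 0 < k
    0<k = subst (0 <_) (sym k≡) (subst (0 <_) (+-comm 2 (U * 4)) z<s)
    1<k : 1 < k
    1<k = subst (1 <_) (sym k≡) (subst (1 <_) (+-comm 2 (U * 4)) (s≤s z<s))
    2<k : 2 < k
    2<k = subst (2 <_) (sym k≡) (+-monoˡ-≤ 2 (≤-trans (s≤s z≤n) (*-monoˡ-≤ 4 1≤U)))

    -- the order of exploration: row 0, row 2 and the strips, then row 1
    c-w : ColReached w
    c-w = col-left 0 w 0<k row0-reached refl
    c-w+2 : ColReached (2 + w)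
    c-w+2 = col-right 0 (1 + w) 0<k row0-reached refl (subst (2 + w <_) (sym M≡) (n≤1+n _))
    row2 : RowReached 2
    row2 = row-below 1 (2 + w) 1<k c-w+2 refl
    columns-of-strips : ∀ x → 1 ≤ x → x < 1 + U * 8 → x < M → ColReached x
    columns-of-strips = proj₁ (strips 2 1 U strip-at row2)
    2<V : 2 < 1 + U * 8
    2<V = s≤s (≤-trans (s≤s (s≤s z≤n)) (*-monoˡ-≤ 8 1≤U))
    1+8U<M : 1 + U * 8 < M
    1+8U<M = ≤-<-trans (s≤s 8U≤w) 1+w<M
    row1 : RowReached 1
    row1 = row-above 1 2 2<k (columns-of-strips 2 (s≤s z≤n) 2<V (<-trans 2<V 1+8U<M)) refl
    c-w+1 : ColReached (1 + w)
    c-w+1 = col-left 1 (1 + w) 1<k row1 refl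
    c-w+3 : ColReached (3 + w)
    c-w+3 = col-right 1 (2 + w) 1<k row1 refl (subst (3 + w <_) (sym M≡) ≤-refl)

    near-w : ∀ d → d + w < 4 + w → ColReached (d + w)
    near-w 0 _ = c-w
    near-w 1 _ = c-w+1
    near-w 2 _ = c-w+2
    near-w 3 _ = c-w+3
    near-w (suc (suc (suc (suc d)))) (s≤s (s≤s (s≤s (s≤s lt)))) = ⊥-elim (<⇒≱ lt (m≤n+m w d))

    all-columns : ∀ x → x < M → ColReached x
    all-columns x x<M with x ≟ 0 | x <? 1 + U * 8
    ... | yes refl | _ = col0-reached
    ... | no x≢0 | yes x<V = columns-of-strips x (n≢0⇒n>0 x≢0) x<V x<M
    ... | no _ | no x≮V = subst ColReached x≡ (near-w (x ∸ w) (subst (_< 4 + w) (sym x≡) (subst (x <_) M≡ x<M)))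
      where x≡ : x ∸ w + w ≡ x
            x≡ = m∸n+n≡m (≤-trans w≤8U+1 (subst (_≤ x) (+-comm 1 (U * 8)) (≮⇒≥ x≮V)))

  small : Small n m
  small = B , solution all-columns , numBlocks≤k

divide8 : ∀ M → Σ ℕ λ U → Σ ℕ λ r → r < 8 × M ≡ U * 8 + r
divide8 M = M / 8 , M % 8 , m%n<n M 8 , trans (m≡m%n+[m/n]*n M 8) (+-comm (M % 8) _)

half : ∀ U s → ⌈ (U * 8 + s) /2⌉ ≡ U * 4 + ⌈ s /2⌉
half zero    s = refl
half (suc U) s = cong (4 +_) (half U s)

m-from : ∀ {m} U s → suc m ≡ U * 8 + suc s → m ≡ U * 8 + s
m-from U s M≡ = suc-injective (trans M≡ (+-suc (U * 8) s))

k-from : ∀ {m} U s → suc m ≡ U * 8 + suc s → ⌈ m /2⌉ ≡ U * 4 + ⌈ s /2⌉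
k-from U s M≡ = trans (cong ⌈_/2⌉ (m-from U s M≡)) (half U s)

upper-bound : ∀ n m → m ≤ n → 5 ≤ m → Small n m
upper-bound n m m≤n 5≤m with divide8 (suc m)
... | zero , 0 , _ , ()
... | suc U , 0 , _ , M≡ = strips-only n m (suc U) 0 m≤n 5≤m z≤n M≡
                            (trans (k-from U 7 (trans M≡ (move8 U))) (solve4 U))
  where move8 : ∀ U → suc U * 8 + 0 ≡ U * 8 + 8
        move8 = solve-∀
        solve4 : ∀ U → U * 4 + 4 ≡ suc U * 4 + 0
        solve4 = solve-∀
... | U , 1 , _ , M≡ = strips-only n m U 1 m≤n 5≤m ≤-refl M≡ (k-from U 0 M≡)
... | U , 2 , _ , M≡ = OneTail.small n m U 1 m≤n 5≤m (s≤s z≤n) M≡ (k-from U 1 M≡)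
... | U , 3 , _ , M≡ = OneTail.small n m U 2 m≤n 5≤m ≤-refl M≡ (k-from U 2 M≡)
... | zero , 4 , _ , M≡ = ⊥-elim (<⇒≱ (s≤s (s≤s (s≤s (s≤s z≤n)))) (subst (5 ≤_) (m-from 0 3 M≡) 5≤m))
... | suc U , 4 , _ , M≡ = HeadScheme.small n m (suc U) (suc U * 8) m≤n (s≤s z≤n)
                             (trans (m-from (suc U) 3 M≡) (+-comm (suc U * 8) 3)) ≤-refl (m≤m+n _ 1) (k-from (suc U) 3 M≡)
... | zero , 5 , _ , M≡ = ⊥-elim (<⇒≱ ≤-refl (subst (5 ≤_) (m-from 0 4 M≡) 5≤m))
... | suc U , 5 , _ , M≡ = HeadScheme.small n m (suc U) (suc U * 8 + 1) m≤n (s≤s z≤n)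
                             (trans (m-from (suc U) 4 M≡) (shift (suc U))) (m≤m+n _ 1) ≤-refl (k-from (suc U) 4 M≡)
  where shift : ∀ U → U * 8 + 4 ≡ 3 + (U * 8 + 1)
        shift = solve-∀
... | U , 6 , _ , M≡ = ThreeTail.small n m U 1 m≤n 5≤m (s≤s z≤n) M≡ (k-from U 5 M≡)
... | U , 7 , _ , M≡ = ThreeTail.small n m U 2 m≤n 5≤m ≤-refl M≡ (k-from U 6 M≡)
... | U , suc (suc (suc (suc (suc (suc (suc (suc _))))))) , s≤s (s≤s (s≤s (s≤s (s≤s (s≤s (s≤s (s≤s ()))))))) , _

mainTheorem5 : ∀ (n m : ℕ) → 6 ≤ m → m ≤ n → OptIs n m ⌈ (m ∸ 1) /2⌉
mainTheorem5 (suc n) (suc m) (s≤s 5≤m) (s≤s m≤n) with upper-bound n m m≤n 5≤m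
... | B , solution , few = (B , solution , ≤-antisym few (lower-bound m≤n B solution)) , lower-bound m≤n
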